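{- Consider the Lie algebra of type $G_2$. Let $\ell\ge 1$ be an integer, $\lambda=\ell\varpi_2$, and $\mu=m_1\varpi_1+m_2\varpi_2$ with $m_1,m_2$ nonnegative integers satisfying $3\ell-1=2m_1+3m_2$. Then $\mathcal{A}(\lambda,\mu)=\{1,s_1\}$. Moreover, $\mathcal{A}(0,\mu)=\emptyset$ for any $\mu=m_1\varpi_1+m_2\varpi_2$ with $m_1,m_2$ nonnegative integers satisfying $3\cdot 0-1=2m_1+3m_2$.
   Context: Type $G_2$: simple roots $\alpha_1$ (short) and $\alpha_2$ (long), positive roots $\alpha_1,\alpha_2,\alpha_1+\alpha_2,2\alpha_1+\alpha_2,3\alpha_1+\alpha_2,3\alpha_1+2\alpha_2$; fundamental weights $\varpi_1=2\alpha_1+\alpha_2$, $\varpi_2=3\alpha_1+2\alpha_2$; $\rho=\varpi_1+\varpi_2$. $W$ is the Weyl group generated by the simple reflections $s_1,s_2$ (reflections in $\alpha_1,\alpha_2$), $1$ its identity. Kostant's partition function $\wp(\xi)$ counts the ways to write $\xi$ as a nonnegative integral combination of positive roots, and $\mathcal{A}(\lambda,\mu)=\{\sigma\in W:\wp(\sigma(\lambda+\rho)-(\mu+\rho))>0\}$. -}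

module Defs where

open import Data.Nat using (ℕ; zero; suc)
open import Data.Integer using (ℤ; +_; _+_; _-_; _*_; -_; ∣_∣)
import Data.Integer as ℤ
open import Data.Product using (_×_; _,_; proj₁; proj₂)
open import Data.List using (List; []; _∷_; map; concatMap; filter; length; foldr; upTo)
open import Data.Vec using (Vec; []; _∷_; zipWith)
import Data.Vec as Vec
open import Relation.Binary.PropositionalEquality using (_≡_)
open import Relation.Nullary.Decidable using (_×-dec_)

-- A vector of the (real span of the) root lattice is written in the
-- basis of simple roots:  (a , b)  means  a α₁ + b α₂.
-- α₁ is short, α₂ is long.  In G₂ the weight lattice equals the root
-- lattice, so integral coordinates suffice.

V : Set
V = ℤ × ℤ

_⊕_ : V → V → V
(a , b) ⊕ (c , d) = (a + c , b + d)

_⊖_ : V → V → V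
(a , b) ⊖ (c , d) = (a - c , b - d)

_·_ : ℤ → V → V
k · (a , b) = (k * a , k * b)

α₁ α₂ : V
α₁ = (+ 1 , + 0)
α₂ = (+ 0 , + 1)

ϖ₁ ϖ₂ ρ : V
ϖ₁ = (+ 2 , + 1)
ϖ₂ = (+ 3 , + 2)
ρ  = ϖ₁ ⊕ ϖ₂

positiveRoots : Vec V 6
positiveRoots =
  (+ 1 , + 0) ∷ (+ 0 , + 1) ∷ (+ 1 , + 1) ∷ (+ 2 , + 1) ∷ (+ 3 , + 1) ∷ (+ 3 , + 2) ∷ []

-- Simple reflections  s_i(v) = v - ⟨v , α_iᵛ⟩ α_i , with the coroot
-- pairings given by the G₂ Cartan matrix (α₁ short):
--   ⟨α₁,α₁ᵛ⟩ = 2, ⟨α₂,α₁ᵛ⟩ = -3, ⟨α₁,α₂ᵛ⟩ = -1, ⟨α₂,α₂ᵛ⟩ = 2.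

pair₁ pair₂ : V → ℤ
pair₁ (a , b) = + 2 * a - + 3 * b
pair₂ (a , b) = - a + + 2 * b

s₁ s₂ : V → V
s₁ v = v ⊖ (pair₁ v · α₁)
s₂ v = v ⊖ (pair₂ v · α₂)

-- Elements of the Weyl group W = ⟨s₁ , s₂⟩ are given by words in the
-- generators; the word  g₁ g₂ … gₖ  denotes the product s_{g₁} s_{g₂} ⋯ s_{gₖ}.
-- Two words are the same element of W iff they act identically.
data Gen : Set where
  g₁ g₂ : Gen

W : Set
W = List Gen

actGen : Gen → V → V
actGen g₁ = s₁
actGen g₂ = s₂

act : W → V → V
act []       v = v
act (g ∷ w)  v = actGen g (act w v)

_≈W_ : W → W → Set
σ ≈W τ = ∀ v → act σ v ≡ act τ v

𝟙 : W
𝟙 = []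

s₁W : W
s₁W = g₁ ∷ []

-- Kostant's partition function: ℘(ξ) = number of tuples
-- (k₁,…,k₆) ∈ ℕ⁶ with  Σ kᵢ βᵢ = ξ  (βᵢ the positive roots).
-- Every positive root has coordinate sum ≥ 1, so in any such tuple each
-- kᵢ ≤ a + b ≤ ∣a∣ + ∣b∣ for ξ = (a , b); hence it suffices to count
-- tuples with entries in {0,…,∣a∣+∣b∣}.

tuples : ℕ → (n : ℕ) → List (Vec ℕ n)
tuples N zero    = [] ∷ []
tuples N (suc n) = concatMap (λ k → map (k ∷_) (tuples N n)) (upTo (suc N))

combo : ∀ {n} → Vec ℕ n → Vec V n → V
combo ks βs = Vec.foldr _ _⊕_ (+ 0 , + 0) (zipWith (λ k β → (+ k) · β) ks βs)

℘ : V → ℕ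
℘ (a , b) =
  length (filter (λ ks → let (c , d) = combo ks positiveRoots
                         in (c ℤ.≟ a) ×-dec (d ℤ.≟ b))
                 (tuples (∣ a ∣ Data.Nat.+ ∣ b ∣) 6))
  where import Data.Nat

_∈𝒜[_,_] : W → V → V → Set
σ ∈𝒜[ λ' , μ ] = 0 Data.Nat.< ℘ (act σ (λ' ⊕ ρ) ⊖ (μ ⊕ ρ))
  where import Data.Nat

module Submission where

-- The twelve elements of the Weyl group act on the root lattice by explicit
-- integer matrices. The constraint 3ℓ − 1 = 2m₁ + 3m₂ forces m₁ = 3c + 1 and
-- ℓ = 2c + m₂ + 1, after which σ(λ+ρ) − (μ+ρ) is affine in (c , m₂). For ten
-- elements its α₂-coordinate has only negative coefficients, so it is not a
-- sum of positive roots and ℘ vanishes; for 1 and s₁ it equals α₁ + (c+1)α₂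
-- and (c+1)α₂, which are. For ℓ = 0 the constraint has no solution.

open import Defs
open import Data.Empty using (⊥)
open import Data.Fin using (zero; suc)
open import Data.Integer using (ℤ; +_; -[1+_]; -_; _+_; _-_; _*_)
import Data.Integer as ℤ
open import Data.Integer.Properties using (pos-+; pos-*; +-injective)
import Data.Integer.Tactic.RingSolver as ℤ-Solver
open import Data.List using ([]; _∷_; length)
open import Data.List.Membership.Propositional using (_∈_; lose)
open import Data.List.Membership.Propositional.Properties using (∈-map⁺; ∈-concatMap⁺; ∈-upTo⁺)
open import Data.List.Properties using (filter-none; filter-some)
import Data.List.Relation.Unary.All as All
import Data.List.Relation.Unary.Any as Any
open import Data.Nat using (ℕ; suc; _≤_; _<_; z≤n; s≤s; NonZero)
import Data.Nat as ℕ
open import Data.Nat.Divisibility using (_∣_; ∣⇒≤; ∣m+n∣m⇒∣n; m∣m*n)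
open import Data.Nat.DivMod using (_divMod_; result)
open import Data.Nat.Properties using (m≤m+n; m≤n+m; *-cancelˡ-≡; <⇒≱; >⇒≢)
import Data.Nat.Tactic.RingSolver as ℕ-Solver
open import Data.Product using (_×_; ∃-syntax; _,_; proj₁; proj₂)
open import Data.Sum using (_⊎_; inj₁; inj₂; [_,_])
import Data.Sum as Sum
open import Data.Vec using (Vec; []; _∷_)
open import Data.Vec.Relation.Unary.All using ([]; _∷_) renaming (All to AllV)
open import Function.Bundles using (_⇔_; mk⇔; Equivalence)
open import Relation.Binary.PropositionalEquality
  using (_≡_; _≢_; refl; sym; trans; cong; cong₂; subst; module ≡-Reasoning)
open import Relation.Nullary using (¬_; Dec; contradiction)
open import Relation.Nullary.Decidable using (_×-dec_)

Matrix : Set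
Matrix = ℤ × ℤ × ℤ × ℤ

apply : Matrix → V → V
apply (p , q , r , s) (a , b) = (p * a + q * b , r * a + s * b)

_⊙_ : Matrix → Matrix → Matrix
(p , q , r , s) ⊙ (p′ , q′ , r′ , s′) =
  (p * p′ + q * r′ , p * q′ + q * s′ , r * p′ + s * r′ , r * q′ + s * s′)

apply-⊙ : ∀ A B v → apply (A ⊙ B) v ≡ apply A (apply B v)
apply-⊙ (p , q , r , s) (p′ , q′ , r′ , s′) (a , b) =
  cong₂ _,_ (row p q p′ q′ r′ s′ a b) (row r s p′ q′ r′ s′ a b)
  where
  row : ∀ p q p′ q′ r′ s′ a b →
        (p * p′ + q * r′) * a + (p * q′ + q * s′) * b ≡ p * (p′ * a + q′ * b) + q * (r′ * a + s′ * b)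
  row = ℤ-Solver.solve-∀

generatorMatrix : Gen → Matrix
generatorMatrix g₁ = (-[1+ 0 ] , + 3 , + 0 , + 1)
generatorMatrix g₂ = (+ 1 , + 0 , + 1 , -[1+ 0 ])

actGen-matrix : ∀ g v → actGen g v ≡ apply (generatorMatrix g) v
actGen-matrix g₁ (a , b) = cong₂ _,_ (s₁-first a b) (s₁-second a b)
  where
  s₁-first : ∀ a b → a - (+ 2 * a - + 3 * b) * + 1 ≡ -[1+ 0 ] * a + + 3 * b
  s₁-first = ℤ-Solver.solve-∀
  s₁-second : ∀ a b → b - (+ 2 * a - + 3 * b) * + 0 ≡ + 0 * a + + 1 * b
  s₁-second = ℤ-Solver.solve-∀
actGen-matrix g₂ (a , b) = cong₂ _,_ (s₂-first a b) (s₂-second a b)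
  where
  s₂-first : ∀ a b → a - (- a + + 2 * b) * + 0 ≡ + 1 * a + + 0 * b
  s₂-first = ℤ-Solver.solve-∀
  s₂-second : ∀ a b → b - (- a + + 2 * b) * + 1 ≡ + 1 * a + -[1+ 0 ] * b
  s₂-second = ℤ-Solver.solve-∀

-- The twelve elements of W, named by reduced words: r₂₁ is s₂ s₁, and
-- w₀ is the longest element.
data WeylElement : Set where
  ε r₁ r₂ r₂₁ r₁₂ r₁₂₁ r₂₁₂ r₂₁₂₁ r₁₂₁₂ r₁₂₁₂₁ r₂₁₂₁₂ w₀ : WeylElement

matrix : WeylElement → Matrix
matrix ε      = (+ 1 , + 0 , + 0 , + 1)
matrix r₁     = (-[1+ 0 ] , + 3 , + 0 , + 1)
matrix r₂     = (+ 1 , + 0 , + 1 , -[1+ 0 ])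
matrix r₂₁    = (-[1+ 0 ] , + 3 , -[1+ 0 ] , + 2)
matrix r₁₂    = (+ 2 , -[1+ 2 ] , + 1 , -[1+ 0 ])
matrix r₁₂₁   = (-[1+ 1 ] , + 3 , -[1+ 0 ] , + 2)
matrix r₂₁₂   = (+ 2 , -[1+ 2 ] , + 1 , -[1+ 1 ])
matrix r₂₁₂₁  = (-[1+ 1 ] , + 3 , -[1+ 0 ] , + 1)
matrix r₁₂₁₂  = (+ 1 , -[1+ 2 ] , + 1 , -[1+ 1 ])
matrix r₁₂₁₂₁ = (-[1+ 0 ] , + 0 , -[1+ 0 ] , + 1)
matrix r₂₁₂₁₂ = (+ 1 , -[1+ 2 ] , + 0 , -[1+ 0 ])
matrix w₀     = (-[1+ 0 ] , + 0 , + 0 , -[1+ 0 ])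

infixr 5 _•_
_•_ : Gen → WeylElement → WeylElement
g₁ • ε      = r₁
g₂ • ε      = r₂
g₁ • r₁     = ε
g₂ • r₁     = r₂₁
g₁ • r₂     = r₁₂
g₂ • r₂     = ε
g₁ • r₂₁    = r₁₂₁
g₂ • r₂₁    = r₁
g₁ • r₁₂    = r₂
g₂ • r₁₂    = r₂₁₂
g₁ • r₁₂₁   = r₂₁
g₂ • r₁₂₁   = r₂₁₂₁
g₁ • r₂₁₂   = r₁₂₁₂
g₂ • r₂₁₂   = r₁₂
g₁ • r₂₁₂₁  = r₁₂₁₂₁
g₂ • r₂₁₂₁  = r₁₂₁
g₁ • r₁₂₁₂  = r₂₁₂
g₂ • r₁₂₁₂  = r₂₁₂₁₂
g₁ • r₁₂₁₂₁ = r₂₁₂₁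
g₂ • r₁₂₁₂₁ = w₀
g₁ • r₂₁₂₁₂ = w₀
g₂ • r₂₁₂₁₂ = r₁₂₁₂
g₁ • w₀     = r₂₁₂₁₂
g₂ • w₀     = r₁₂₁₂₁

matrix-• : ∀ g e → generatorMatrix g ⊙ matrix e ≡ matrix (g • e)
matrix-• g₁ ε      = refl
matrix-• g₂ ε      = refl
matrix-• g₁ r₁     = refl
matrix-• g₂ r₁     = refl
matrix-• g₁ r₂     = refl
matrix-• g₂ r₂     = refl
matrix-• g₁ r₂₁    = refl
matrix-• g₂ r₂₁    = refl
matrix-• g₁ r₁₂    = refl
matrix-• g₂ r₁₂    = refl
matrix-• g₁ r₁₂₁   = refl
matrix-• g₂ r₁₂₁   = refl
matrix-• g₁ r₂₁₂   = refl
matrix-• g₂ r₂₁₂   = refl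
matrix-• g₁ r₂₁₂₁  = refl
matrix-• g₂ r₂₁₂₁  = refl
matrix-• g₁ r₁₂₁₂  = refl
matrix-• g₂ r₁₂₁₂  = refl
matrix-• g₁ r₁₂₁₂₁ = refl
matrix-• g₂ r₁₂₁₂₁ = refl
matrix-• g₁ r₂₁₂₁₂ = refl
matrix-• g₂ r₂₁₂₁₂ = refl
matrix-• g₁ w₀     = refl
matrix-• g₂ w₀     = refl

element : W → WeylElement
element []      = ε
element (g ∷ w) = g • element w

apply-identity : ∀ v → apply (matrix ε) v ≡ v
apply-identity (a , b) = cong₂ _,_ (first a b) (second a b)
  where
  first : ∀ a b → + 1 * a + + 0 * b ≡ a
  first = ℤ-Solver.solve-∀
  second : ∀ a b → + 0 * a + + 1 * b ≡ b
  second = ℤ-Solver.solve-∀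

act-matrix : ∀ σ v → act σ v ≡ apply (matrix (element σ)) v
act-matrix []      v = sym (apply-identity v)
act-matrix (g ∷ σ) v = begin
  actGen g (act σ v)                                       ≡⟨ cong (actGen g) (act-matrix σ v) ⟩
  actGen g (apply (matrix (element σ)) v)                  ≡⟨ actGen-matrix g _ ⟩
  apply (generatorMatrix g) (apply (matrix (element σ)) v) ≡⟨ apply-⊙ (generatorMatrix g) _ v ⟨
  apply (generatorMatrix g ⊙ matrix (element σ)) v         ≡⟨ cong (λ A → apply A v) (matrix-• g (element σ)) ⟩
  apply (matrix (g • element σ)) v                         ∎
  where open ≡-Reasoning

≈W-from-element : ∀ σ τ → element σ ≡ element τ → σ ≈W τ
≈W-from-element σ τ eq v =
  trans (act-matrix σ v) (trans (cong (λ e → apply (matrix e) v) eq) (sym (act-matrix τ v)))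

∈𝒜-resp-≈W : ∀ λ′ μ {σ τ} → σ ≈W τ → τ ∈𝒜[ λ′ , μ ] → σ ∈𝒜[ λ′ , μ ]
∈𝒜-resp-≈W λ′ μ σ≈τ = subst (λ v → 0 < ℘ (v ⊖ (μ ⊕ ρ))) (sym (σ≈τ (λ′ ⊕ ρ)))

tuples-complete : ∀ N n (ks : Vec ℕ n) → AllV (_≤ N) ks → ks ∈ tuples N n
tuples-complete N ℕ.zero    []       []          = Any.here refl
tuples-complete N (ℕ.suc n) (k ∷ ks) (k≤N ∷ ks≤N) =
  ∈-concatMap⁺ _ (Any.map (λ { refl → ∈-map⁺ (k ∷_) (tuples-complete N n ks ks≤N) })
                          (∈-upTo⁺ (s≤s k≤N)))

combo-α₂-nonnegative : ∀ ks → ∃[ d ] proj₂ (combo ks positiveRoots) ≡ + d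
combo-α₂-nonnegative (k₁ ∷ k₂ ∷ k₃ ∷ k₄ ∷ k₅ ∷ k₆ ∷ [])
  rewrite sym (pos-* k₁ 0) | sym (pos-* k₂ 1) | sym (pos-* k₃ 1)
        | sym (pos-* k₄ 1) | sym (pos-* k₅ 1) | sym (pos-* k₆ 2) = _ , refl

combo-α₁α₂ : ∀ a b → combo (a ∷ b ∷ 0 ∷ 0 ∷ 0 ∷ 0 ∷ []) positiveRoots ≡ (+ a , + b)
combo-α₁α₂ a b = cong₂ _,_ (first (+ a) (+ b)) (second (+ a) (+ b))
  where
  first : ∀ A B → A * + 1 + (B * + 0 + + 0) ≡ A
  first = ℤ-Solver.solve-∀
  second : ∀ A B → A * + 0 + (B * + 1 + + 0) ≡ B
  second = ℤ-Solver.solve-∀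

Represents : ℤ → ℤ → Vec ℕ 6 → Set
Represents a b ks = proj₁ (combo ks positiveRoots) ≡ a × proj₂ (combo ks positiveRoots) ≡ b

-- Definitionally the decision procedure filtered on in ℘.
represents? : ∀ a b ks → Dec (Represents a b ks)
represents? a b ks = (proj₁ (combo ks positiveRoots) ℤ.≟ a) ×-dec (proj₂ (combo ks positiveRoots) ℤ.≟ b)

℘-positive : ∀ a b → 0 < ℘ (+ a , + b)
℘-positive a b =
  filter-some (represents? _ _) (lose (tuples-complete _ 6 _ bounded) (cong proj₁ eq , cong proj₂ eq))
  where
  eq : combo (a ∷ b ∷ 0 ∷ 0 ∷ 0 ∷ 0 ∷ []) positiveRoots ≡ (+ a , + b)
  eq = combo-α₁α₂ a b
  bounded : AllV (_≤ a ℕ.+ b) (a ∷ b ∷ 0 ∷ 0 ∷ 0 ∷ 0 ∷ [])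
  bounded = m≤m+n a b ∷ m≤n+m b a ∷ z≤n ∷ z≤n ∷ z≤n ∷ z≤n ∷ []

℘-α₂-negative : ∀ a n → ℘ (a , -[1+ n ]) ≡ 0
℘-α₂-negative a n =
  cong length (filter-none (represents? a -[1+ n ]) {tuples (ℤ.∣ a ∣ ℕ.+ suc n) 6} (All.universal α₂-mismatch _))
  where
  α₂-mismatch : ∀ ks → ¬ Represents a -[1+ n ] ks
  α₂-mismatch ks (_ , eq) with combo-α₂-nonnegative ks
  ... | d , nonneg with trans (sym nonneg) eq
  ... | ()

weightλ weightμ : ℕ → ℕ → V
weightλ c m = (+ (2 ℕ.* c ℕ.+ m ℕ.+ 1)) · ϖ₂
weightμ c m = ((+ (3 ℕ.* c ℕ.+ 1)) · ϖ₁) ⊕ ((+ m) · ϖ₂)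

difference : Matrix → ℕ → ℕ → V
difference A c m = apply A (weightλ c m ⊕ ρ) ⊖ (weightμ c m ⊕ ρ)

Affine : Set
Affine = ℤ × ℤ × ℤ

⟦_⟧ : Affine → ℕ → ℕ → ℤ
⟦ k , j , t ⟧ c m = k * + c + j * + m + t

-- The rows of differenceForm A hold the coefficients of c, m and 1 in
-- the two coordinates of difference A c m, read off from
-- weightλ c m ⊕ ρ = (6c + 3m + 8 , 4c + 2m + 5) and weightμ c m ⊕ ρ = (6c + 3m + 7 , 3c + 2m + 4).
differenceForm : Matrix → Affine × Affine
differenceForm (p , q , r , s) =
  (+ 6 * p + + 4 * q - + 6 , + 3 * p + + 2 * q - + 3 , + 8 * p + + 5 * q - + 7) ,
  (+ 6 * r + + 4 * s - + 3 , + 3 * r + + 2 * s - + 2 , + 8 * r + + 5 * s - + 4)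

difference-affine : ∀ A c m →
  difference A c m ≡ (⟦ proj₁ (differenceForm A) ⟧ c m , ⟦ proj₂ (differenceForm A) ⟧ c m)
difference-affine (p , q , r , s) c m =
  trans (cong₂ (λ L L′ → apply (p , q , r , s) ((L · ϖ₂) ⊕ ρ) ⊖ (((L′ · ϖ₁) ⊕ ((+ m) · ϖ₂)) ⊕ ρ))
               λ-coefficient μ-coefficient)
        (cong₂ _,_ (first p q (+ c) (+ m)) (second r s (+ c) (+ m)))
  where
  open ≡-Reasoning
  λ-coefficient : + (2 ℕ.* c ℕ.+ m ℕ.+ 1) ≡ + 2 * + c + + m + + 1
  λ-coefficient = begin
    + (2 ℕ.* c ℕ.+ m ℕ.+ 1)   ≡⟨ pos-+ (2 ℕ.* c ℕ.+ m) 1 ⟩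
    + (2 ℕ.* c ℕ.+ m) + + 1   ≡⟨ cong (_+ + 1) (pos-+ (2 ℕ.* c) m) ⟩
    + (2 ℕ.* c) + + m + + 1   ≡⟨ cong (λ x → x + + m + + 1) (pos-* 2 c) ⟩
    + 2 * + c + + m + + 1     ∎
  μ-coefficient : + (3 ℕ.* c ℕ.+ 1) ≡ + 3 * + c + + 1
  μ-coefficient = trans (pos-+ (3 ℕ.* c) 1) (cong (_+ + 1) (pos-* 3 c))
  first : ∀ p q C M →
    p * ((+ 2 * C + M + + 1) * + 3 + + 5) + q * ((+ 2 * C + M + + 1) * + 2 + + 3)
      - (((+ 3 * C + + 1) * + 2 + M * + 3) + + 5)
    ≡ (+ 6 * p + + 4 * q - + 6) * C + (+ 3 * p + + 2 * q - + 3) * M + (+ 8 * p + + 5 * q - + 7)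
  first = ℤ-Solver.solve-∀
  second : ∀ r s C M →
    r * ((+ 2 * C + M + + 1) * + 3 + + 5) + s * ((+ 2 * C + M + + 1) * + 2 + + 3)
      - (((+ 3 * C + + 1) * + 1 + M * + 2) + + 3)
    ≡ (+ 6 * r + + 4 * s - + 3) * C + (+ 3 * r + + 2 * s - + 2) * M + (+ 8 * r + + 5 * s - + 4)
  second = ℤ-Solver.solve-∀

⟦⟧-negative : ∀ {k j t} c m →
  ⟦ -[1+ k ] , -[1+ j ] , -[1+ t ] ⟧ c m ≡ -[1+ t ℕ.+ (suc k ℕ.* c ℕ.+ suc j ℕ.* m) ]
⟦⟧-negative {k} {j} {t} c m = begin
  -[1+ k ] * + c + -[1+ j ] * + m + -[1+ t ]         ≡⟨ negate (+ suc k) (+ suc j) (+ suc t) (+ c) (+ m) ⟩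
  - (+ suc t + (+ suc k * + c + + suc j * + m))
    ≡⟨ cong (λ x → - (+ suc t + x)) (sym (cong₂ _+_ (pos-* (suc k) c) (pos-* (suc j) m))) ⟩
  - (+ suc t + (+ (suc k ℕ.* c) + + (suc j ℕ.* m)))  ∎
  where
  open ≡-Reasoning
  negate : ∀ K J T C M → - K * C + - J * M + - T ≡ - (T + (K * C + J * M))
  negate = ℤ-Solver.solve-∀

℘-difference-α₂-negative : ∀ {k j t} c m e →
  proj₂ (differenceForm (matrix e)) ≡ (-[1+ k ] , -[1+ j ] , -[1+ t ]) → ℘ (difference (matrix e) c m) ≡ 0
℘-difference-α₂-negative {k} {j} {t} c m e form = begin
  ℘ (difference (matrix e) c m)                          ≡⟨ cong ℘ (difference-affine (matrix e) c m) ⟩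
  ℘ (α₁-part , ⟦ proj₂ (differenceForm (matrix e)) ⟧ c m) ≡⟨ cong (λ f → ℘ (α₁-part , ⟦ f ⟧ c m)) form ⟩
  ℘ (α₁-part , ⟦ -[1+ k ] , -[1+ j ] , -[1+ t ] ⟧ c m)    ≡⟨ cong (λ b → ℘ (α₁-part , b)) (⟦⟧-negative {k} {j} {t} c m) ⟩
  ℘ (α₁-part , -[1+ _ ])                                  ≡⟨ ℘-α₂-negative α₁-part _ ⟩
  0                                                       ∎
  where
  open ≡-Reasoning
  α₁-part : ℤ
  α₁-part = ⟦ proj₁ (differenceForm (matrix e)) ⟧ c m

℘-difference-positive⇒ε⊎r₁ : ∀ c m e → 0 < ℘ (difference (matrix e) c m) → e ≡ ε ⊎ e ≡ r₁
℘-difference-positive⇒ε⊎r₁ c m ε      _ = inj₁ refl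
℘-difference-positive⇒ε⊎r₁ c m r₁     _ = inj₂ refl
℘-difference-positive⇒ε⊎r₁ c m r₂     h = contradiction (℘-difference-α₂-negative c m r₂ refl) (>⇒≢ h)
℘-difference-positive⇒ε⊎r₁ c m r₂₁    h = contradiction (℘-difference-α₂-negative c m r₂₁ refl) (>⇒≢ h)
℘-difference-positive⇒ε⊎r₁ c m r₁₂    h = contradiction (℘-difference-α₂-negative c m r₁₂ refl) (>⇒≢ h)
℘-difference-positive⇒ε⊎r₁ c m r₁₂₁   h = contradiction (℘-difference-α₂-negative c m r₁₂₁ refl) (>⇒≢ h)
℘-difference-positive⇒ε⊎r₁ c m r₂₁₂   h = contradiction (℘-difference-α₂-negative c m r₂₁₂ refl) (>⇒≢ h)
℘-difference-positive⇒ε⊎r₁ c m r₂₁₂₁  h = contradiction (℘-difference-α₂-negative c m r₂₁₂₁ refl) (>⇒≢ h)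
℘-difference-positive⇒ε⊎r₁ c m r₁₂₁₂  h = contradiction (℘-difference-α₂-negative c m r₁₂₁₂ refl) (>⇒≢ h)
℘-difference-positive⇒ε⊎r₁ c m r₁₂₁₂₁ h = contradiction (℘-difference-α₂-negative c m r₁₂₁₂₁ refl) (>⇒≢ h)
℘-difference-positive⇒ε⊎r₁ c m r₂₁₂₁₂ h = contradiction (℘-difference-α₂-negative c m r₂₁₂₁₂ refl) (>⇒≢ h)
℘-difference-positive⇒ε⊎r₁ c m w₀     h = contradiction (℘-difference-α₂-negative c m w₀ refl) (>⇒≢ h)

⟦1,0,1⟧ : ∀ c m → ⟦ + 1 , + 0 , + 1 ⟧ c m ≡ + suc c
⟦1,0,1⟧ c m = lemma (+ c) (+ m)
  where
  lemma : ∀ C M → + 1 * C + + 0 * M + + 1 ≡ + 1 + C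
  lemma = ℤ-Solver.solve-∀

difference-ε : ∀ c m → difference (matrix ε) c m ≡ (+ 1 , + suc c)
difference-ε c m = trans (difference-affine (matrix ε) c m) (cong (+ 1 ,_) (⟦1,0,1⟧ c m))

difference-r₁ : ∀ c m → difference (matrix r₁) c m ≡ (+ 0 , + suc c)
difference-r₁ c m = trans (difference-affine (matrix r₁) c m) (cong (+ 0 ,_) (⟦1,0,1⟧ c m))

∈𝒜⇔℘-difference-positive : ∀ c m σ →
  σ ∈𝒜[ weightλ c m , weightμ c m ] ⇔ 0 < ℘ (difference (matrix (element σ)) c m)
∈𝒜⇔℘-difference-positive c m σ =
  mk⇔ (subst positive (act-matrix σ _)) (subst positive (sym (act-matrix σ _)))
  where
  positive : V → Set
  positive v = 0 < ℘ (v ⊖ (weightμ c m ⊕ ρ))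

∈𝒜[λ,μ]⇔≈𝟙⊎≈s₁ : ∀ c m σ → σ ∈𝒜[ weightλ c m , weightμ c m ] ⇔ (σ ≈W 𝟙 ⊎ σ ≈W s₁W)
∈𝒜[λ,μ]⇔≈𝟙⊎≈s₁ c m σ = mk⇔ to [ 𝟙-case , s₁-case ]
  where
  to : σ ∈𝒜[ weightλ c m , weightμ c m ] → σ ≈W 𝟙 ⊎ σ ≈W s₁W
  to σ∈𝒜 = Sum.map (≈W-from-element σ 𝟙) (≈W-from-element σ s₁W)
    (℘-difference-positive⇒ε⊎r₁ c m (element σ) (Equivalence.to (∈𝒜⇔℘-difference-positive c m σ) σ∈𝒜))
  positive-at : ∀ {a b} e → difference (matrix e) c m ≡ (+ a , + b) → 0 < ℘ (difference (matrix e) c m)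
  positive-at {a} {b} _ eq = subst (λ v → 0 < ℘ v) (sym eq) (℘-positive a b)
  𝟙-case : σ ≈W 𝟙 → σ ∈𝒜[ weightλ c m , weightμ c m ]
  𝟙-case σ≈𝟙 = ∈𝒜-resp-≈W (weightλ c m) (weightμ c m) {σ} {𝟙} σ≈𝟙
    (Equivalence.from (∈𝒜⇔℘-difference-positive c m 𝟙) (positive-at ε (difference-ε c m)))
  s₁-case : σ ≈W s₁W → σ ∈𝒜[ weightλ c m , weightμ c m ]
  s₁-case σ≈s₁ = ∈𝒜-resp-≈W (weightλ c m) (weightμ c m) {σ} {s₁W} σ≈s₁
    (Equivalence.from (∈𝒜⇔℘-difference-positive c m s₁W) (positive-at r₁ (difference-r₁ c m)))

+m-1≡+n⇒m≡n+1 : ∀ m n → + m - + 1 ≡ + n → m ≡ n ℕ.+ 1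
+m-1≡+n⇒m≡n+1 m n eq = +-injective (trans (add-back (+ m)) (cong (_+ + 1) eq))
  where
  add-back : ∀ i → i ≡ i - + 1 + + 1
  add-back = ℤ-Solver.solve-∀

n*a≢n*b+r : ∀ n a b r .{{_ : NonZero r}} → r < n → n ℕ.* a ≢ n ℕ.* b ℕ.+ r
n*a≢n*b+r n a b r r<n eq = <⇒≱ r<n (∣⇒≤ (∣m+n∣m⇒∣n (subst (n ∣_) eq (m∣m*n a)) (m∣m*n b)))

parametrise : ∀ ℓ m₁ m₂ → 3 ℕ.* ℓ ≡ 2 ℕ.* m₁ ℕ.+ 3 ℕ.* m₂ ℕ.+ 1 →
              ∃[ c ] ℓ ≡ 2 ℕ.* c ℕ.+ m₂ ℕ.+ 1 × m₁ ≡ 3 ℕ.* c ℕ.+ 1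
parametrise ℓ m₁ m₂ eq with m₁ divMod 3
... | result c zero refl =
  contradiction (trans eq (remainder₀ c m₂)) (n*a≢n*b+r 3 ℓ (2 ℕ.* c ℕ.+ m₂) 1 (s≤s (s≤s z≤n)))
  where
  remainder₀ : ∀ c m → 2 ℕ.* (0 ℕ.+ c ℕ.* 3) ℕ.+ 3 ℕ.* m ℕ.+ 1 ≡ 3 ℕ.* (2 ℕ.* c ℕ.+ m) ℕ.+ 1
  remainder₀ = ℕ-Solver.solve-∀
... | result c (suc zero) refl =
  c , *-cancelˡ-≡ ℓ _ 3 (trans eq (remainder₁ c m₂)) , reorder c
  where
  remainder₁ : ∀ c m → 2 ℕ.* (1 ℕ.+ c ℕ.* 3) ℕ.+ 3 ℕ.* m ℕ.+ 1 ≡ 3 ℕ.* (2 ℕ.* c ℕ.+ m ℕ.+ 1)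
  remainder₁ = ℕ-Solver.solve-∀
  reorder : ∀ c → 1 ℕ.+ c ℕ.* 3 ≡ 3 ℕ.* c ℕ.+ 1
  reorder = ℕ-Solver.solve-∀
... | result c (suc (suc zero)) refl =
  contradiction (trans eq (remainder₂ c m₂)) (n*a≢n*b+r 3 ℓ (2 ℕ.* c ℕ.+ m₂ ℕ.+ 1) 2 (s≤s (s≤s (s≤s z≤n))))
  where
  remainder₂ : ∀ c m → 2 ℕ.* (2 ℕ.+ c ℕ.* 3) ℕ.+ 3 ℕ.* m ℕ.+ 1 ≡ 3 ℕ.* (2 ℕ.* c ℕ.+ m ℕ.+ 1) ℕ.+ 2
  remainder₂ = ℕ-Solver.solve-∀

∈𝒜[ℓϖ₂,μ]⇔≈𝟙⊎≈s₁ : ∀ ℓ m₁ m₂ → 3 ℕ.* ℓ ≡ 2 ℕ.* m₁ ℕ.+ 3 ℕ.* m₂ ℕ.+ 1 → ∀ σ →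
  σ ∈𝒜[ (+ ℓ) · ϖ₂ , ((+ m₁) · ϖ₁) ⊕ ((+ m₂) · ϖ₂) ] ⇔ (σ ≈W 𝟙 ⊎ σ ≈W s₁W)
∈𝒜[ℓϖ₂,μ]⇔≈𝟙⊎≈s₁ ℓ m₁ m₂ eq with parametrise ℓ m₁ m₂ eq
... | c , refl , refl = ∈𝒜[λ,μ]⇔≈𝟙⊎≈s₁ c m₂

theorem1p3 :
    ((ℓ m₁ m₂ : ℕ) → 1 ≤ ℓ →
      + (3 ℕ.* ℓ) - + 1 ≡ + (2 ℕ.* m₁ ℕ.+ 3 ℕ.* m₂) →
      (σ : W) →
        (σ ∈𝒜[ (+ ℓ) · ϖ₂ , ((+ m₁) · ϖ₁) ⊕ ((+ m₂) · ϖ₂) ]) ⇔ (σ ≈W 𝟙 ⊎ σ ≈W s₁W))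
    ×
    ((m₁ m₂ : ℕ) →
      + (3 ℕ.* 0) - + 1 ≡ + (2 ℕ.* m₁ ℕ.+ 3 ℕ.* m₂) →
      (σ : W) → σ ∈𝒜[ (+ 0) · ϖ₂ , ((+ m₁) · ϖ₁) ⊕ ((+ m₂) · ϖ₂) ] → ⊥)
theorem1p3 =
  (λ ℓ m₁ m₂ _ eq → ∈𝒜[ℓϖ₂,μ]⇔≈𝟙⊎≈s₁ ℓ m₁ m₂ (+m-1≡+n⇒m≡n+1 (3 ℕ.* ℓ) _ eq)) ,
  λ { _ _ () }
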